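{- Let $m,n\ge 3$ be integers. The vertex set of $\Delta_{m,n}$ has a partition $\{S^0,S^1,\ldots,S^6\}$ into seven $1$-perfect codes of $\Delta_{m,n}$ if and only if $m$ and $n$ are both multiples of $7$. Each member $S^i$ of such a partition is a translate of $S^0$ and has cardinality $mn/7$.
   Context: For integers $m,n\ge 3$, $\Delta_{m,n}$ is the toroidal triangular lattice graph with vertex set $\mathbb{Z}_m\times\mathbb{Z}_n$, in which $(i,j)$ is adjacent to $(i\pm1,j)$, $(i,j\pm1)$, $(i+1,j-1)$ and $(i-1,j+1)$ (indices mod $m$ and mod $n$ respectively); equivalently it is the Cartesian product $C_m\times C_n$ with the anti-diagonal edge $\{(i,j+1),(i+1,j)\}$ added in each elementary $4$-cycle. A $1$-perfect code in a graph $G$ is an independent vertex set $S$ such that every vertex not in $S$ is adjacent to exactly one vertex of $S$. A translate of a subset of $\Delta_{m,n}$ is its image under a map $(i,j)\mapsto(i+a,j+b)$. -}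

module Defs where

open import Data.Nat using (ℕ; suc; _+_; _*_; _%_; _≤_; NonZero)
open import Data.Nat.DivMod using (m%n<n)
open import Data.Fin using (Fin; toℕ; fromℕ<)
open import Data.Product using (_×_; _,_; Σ; ∃; ∃-syntax)
open import Data.Sum using (_⊎_)
open import Data.Empty using (⊥)
open import Data.List using (List; length; filter)
open import Data.Fin.Base using ()
open import Data.List using (allFin; cartesianProduct)
open import Relation.Nullary using (¬_; Dec)
open import Relation.Binary.PropositionalEquality using (_≡_)

V : ℕ → ℕ → Set
V m n = Fin m × Fin n

shift : ∀ {m} .{{_ : NonZero m}} → Fin m → ℕ → Fin m
shift {m} i k = fromℕ< (m%n<n (toℕ i + k) m)

-- Subtracting 1 mod m is realised as adding m-1 = pred m.
-- (For m,n ≥ 3 the six neighbours are distinct and differ from the vertex.)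
Adj : ∀ {m n} .{{_ : NonZero m}} .{{_ : NonZero n}} → V m n → V m n → Set
Adj {suc m'} {suc n'} (i , j) w =
    (w ≡ (shift i 1 , j))
  ⊎ (w ≡ (shift i m' , j))
  ⊎ (w ≡ (i , shift j 1))
  ⊎ (w ≡ (i , shift j n'))
  ⊎ (w ≡ (shift i 1 , shift j n'))
  ⊎ (w ≡ (shift i m' , shift j 1))

Subset : ℕ → ℕ → Set₁
Subset m n = V m n → Set

IsPerfectCode : ∀ {m n} .{{_ : NonZero m}} .{{_ : NonZero n}} → Subset m n → Set
IsPerfectCode {m} {n} S =
    (∀ u v → S u → S v → ¬ Adj u v)
  × (∀ v → ¬ S v →
       (∃[ u ] (S u × Adj v u))
     × (∀ u u' → S u → Adj v u → S u' → Adj v u' → u ≡ u'))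

IsTranslateOf : ∀ {m n} .{{_ : NonZero m}} .{{_ : NonZero n}} →
                Subset m n → Subset m n → Set
IsTranslateOf {m} {n} T S =
  ∃[ a ] ∃[ b ] ((∀ v → T v → ∃[ u ] (S u × v ≡ τ a b u))
               × (∀ u → S u → T (τ a b u)))
  where
  τ : ℕ → ℕ → V m n → V m n
  τ a b (i , j) = (shift i a , shift j b)

-- A partition of V into seven classes, given by the class map c : V → Fin 7;
-- S^k = c⁻¹(k).
Class : ∀ {m n} → (V m n → Fin 7) → Fin 7 → Subset m n
Class c k v = c v ≡ k

vertices : (m n : ℕ) → List (V m n)
vertices m n = cartesianProduct (allFin m) (allFin n)

classSize : ∀ {m n} → (V m n → Fin 7) → Fin 7 → ℕ
classSize {m} {n} c k = length (filter (λ v → c v Data.Fin.≟ k) (vertices m n))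
  where import Data.Fin

SevenCodePartition : ∀ {m n} .{{_ : NonZero m}} .{{_ : NonZero n}} → (V m n → Fin 7) → Set
SevenCodePartition c = ∀ k → IsPerfectCode (Class c k)

-- A colouring c : V m n → Fin 7 has seven perfect codes as classes iff every closed
-- neighbourhood N[v] (v and its six neighbours) is rainbow, i.e. carries all seven colours.
-- We lift c to a doubly periodic colouring of the quarter plane ℕ × ℕ.  A local case analysis
-- (rigidity) shows that rainbow neighbourhoods force the class of each point p to contain
-- p + (1,2) and p + (3,-1), or, after transposing the plane, the mirrored vectors.  With
-- periodicity this makes c a relabelling of the linear colouring (x , y) ↦ x + 3y mod 7 or of
-- its transpose, so that 7 divides both periods.  Linearity then shows that every class is a
-- vertical translate of class 0 and meets each column {i} × ℤₙ in n/7 vertices, whence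
-- 7 · |Sᵏ| = mn.  Conversely, for 7 ∣ m and 7 ∣ n the linear colouring is such a partition,
-- because the six moves change x + 3y by the six non-zero residues modulo 7.
-- Finite facts about the residues modulo 7 are confirmed by evaluation.
module Submission where

open import Defs
open import Data.Nat using (ℕ; zero; suc; pred; _+_; _*_; _∸_; _%_; _/_; _<_; _≤_; NonZero; s≤s; z≤n)
import Data.Nat as ℕ
open import Data.Nat.Properties using (+-comm; +-assoc; *-suc; +-identityʳ; *-identityʳ; <-≤-trans; +-commutativeSemigroup)
open import Data.Nat.DivMod using (m%n<n; m%n%n≡m%n; %-distribˡ-+; %-distribˡ-*; [m+kn]%n≡m%n; [m+n]%n≡m%n; m<n⇒m%n≡m; m≡m%n+[m/n]*n; m∣n⇒o%n%m≡o%m; %-pred-≡0)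
open import Data.Nat.Divisibility using (_∣_; m%n≡0⇒n∣m; n∣m⇒m%n≡0; ∣m+n∣m⇒∣n; ∣n⇒∣m*n; ∣m⇒∣m*n; ∣-refl)
open import Data.Nat.Tactic.RingSolver using (solve-∀)
open import Algebra.Properties.CommutativeSemigroup +-commutativeSemigroup using (x∙yz≈y∙xz)
open import Data.Fin using (Fin; toℕ; fromℕ<; _≟_)
import Data.Fin as Fin
open import Data.Fin.Properties using (toℕ-fromℕ<; fromℕ<-cong; fromℕ<-toℕ; toℕ<n; all?; any?)
open import Data.Bool using (Bool; true; false; if_then_else_)
open import Data.List using (List; []; _∷_; _++_; map; filter; length; tabulate; allFin; cartesianProduct)
open import Data.List.Properties using (filter-++; length-++; length-tabulate; map-tabulate)
open import Data.Product using (_×_; _,_; proj₁; proj₂; ∃; ∃-syntax; swap)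
open import Data.Sum using (_⊎_; inj₁; inj₂)
open import Data.Empty using (⊥; ⊥-elim)
open import Function.Bundles using (_⇔_; mk⇔)
open import Relation.Nullary using (Dec; does; yes; no; ¬_)
open import Relation.Nullary.Decidable using (True; toWitness; does-⇔; _⊎-dec_)
open import Relation.Unary using (Decidable)
open import Relation.Binary.PropositionalEquality using (_≡_; _≢_; refl; sym; trans; cong; cong₂; subst; subst₂; module ≡-Reasoning)
open ≡-Reasoning

%-cong-+ : ∀ k .{{_ : NonZero k}} {a a' b b'} → a % k ≡ a' % k → b % k ≡ b' % k → (a + b) % k ≡ (a' + b') % k
%-cong-+ k {a} {a'} {b} {b'} ea eb = begin
  (a + b) % k              ≡⟨ %-distribˡ-+ a b k ⟩
  (a % k + b % k) % k      ≡⟨ cong₂ (λ r s → (r + s) % k) ea eb ⟩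
  (a' % k + b' % k) % k    ≡⟨ %-distribˡ-+ a' b' k ⟨
  (a' + b') % k            ∎

%-congˡ-* : ∀ k .{{_ : NonZero k}} c {a a'} → a % k ≡ a' % k → (c * a) % k ≡ (c * a') % k
%-congˡ-* k c {a} {a'} ea = begin
  (c * a) % k              ≡⟨ %-distribˡ-* c a k ⟩
  (c % k * (a % k)) % k    ≡⟨ cong (λ r → (c % k * r) % k) ea ⟩
  (c % k * (a' % k)) % k   ≡⟨ %-distribˡ-* c a' k ⟨
  (c * a') % k             ∎

-- Residues below k cancel: a + x ≡ b + x (mod k) with a, b < k forces a ≡ b,
-- because adding (k - 1)·x to a + x gives a + x·k ≡ a.
+-cancelʳ-% : ∀ k .{{_ : NonZero k}} {a b} x → a < k → b < k → (a + x) % k ≡ (b + x) % k → a ≡ b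
+-cancelʳ-% (suc k) {a} {b} x a<k b<k eq =
  trans (recover a a<k) (trans (%-cong-+ (suc k) {a + x} {b + x} {x * k} {x * k} eq refl) (sym (recover b b<k)))
  where
  recover : ∀ r → r < suc k → r ≡ (r + x + x * k) % suc k
  recover r r<k = begin
    r                        ≡⟨ m<n⇒m%n≡m r<k ⟨
    r % suc k                ≡⟨ [m+kn]%n≡m%n r x (suc k) ⟨
    (r + x * suc k) % suc k  ≡⟨ cong (λ z → (r + z) % suc k) (*-suc x k) ⟩
    (r + (x + x * k)) % suc k ≡⟨ cong (_% suc k) (+-assoc r x (x * k)) ⟨
    (r + x + x * k) % suc k  ∎

+-cancelˡ-% : ∀ k .{{_ : NonZero k}} {a b} x → a < k → b < k → (x + a) % k ≡ (x + b) % k → a ≡ b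
+-cancelˡ-% k {a} {b} x a<k b<k eq =
  +-cancelʳ-% k x a<k b<k (trans (cong (_% k) (+-comm a x)) (trans eq (cong (_% k) (+-comm x b))))

-- x mod k as an element of Fin k.  By definition  shift i e = residue k (toℕ i + e).
residue : ∀ k .{{_ : NonZero k}} → ℕ → Fin k
residue k x = fromℕ< (m%n<n x k)

module _ (k : ℕ) .{{_ : NonZero k}} where

  toℕ-residue : ∀ x → toℕ (residue k x) ≡ x % k
  toℕ-residue x = toℕ-fromℕ< (m%n<n x k)

  residue-cong : ∀ {x y} → x % k ≡ y % k → residue k x ≡ residue k y
  residue-cong {x} {y} eq = fromℕ<-cong _ _ eq (m%n<n x k) (m%n<n y k)

  residue-toℕ : ∀ (i : Fin k) → residue k (toℕ i) ≡ i
  residue-toℕ i = trans (fromℕ<-cong _ (toℕ i) (m<n⇒m%n≡m (toℕ<n i)) (m%n<n (toℕ i) k) (toℕ<n i))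
                        (fromℕ<-toℕ i (toℕ<n i))

  residue-periodic : ∀ x → residue k (k + x) ≡ residue k x
  residue-periodic x = residue-cong (trans (cong (_% k) (+-comm k x)) ([m+n]%n≡m%n x k))

  shift-residue : ∀ x e → shift (residue k x) e ≡ residue k (x + e)
  shift-residue x e = residue-cong (begin
    (toℕ (residue k x) + e) % k  ≡⟨ cong (λ r → (r + e) % k) (toℕ-residue x) ⟩
    (x % k + e) % k              ≡⟨ %-cong-+ k {x % k} {x} {e} {e} (m%n%n≡m%n x k) refl ⟩
    (x + e) % k                  ∎)

  shift-zero : ∀ (i : Fin k) → shift i 0 ≡ i
  shift-zero i = trans (residue-cong (cong (_% k) (+-comm (toℕ i) 0))) (residue-toℕ i)

  residue-cancel : ∀ {a b} x → a < k → b < k → residue k (a + x) ≡ residue k (b + x) → a ≡ b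
  residue-cancel {a} {b} x a<k b<k eq = +-cancelʳ-% k x a<k b<k
    (trans (sym (toℕ-residue (a + x))) (trans (cong toℕ eq) (toℕ-residue (b + x))))

by-evaluation : ∀ {P : ℕ → Set} (P? : ∀ r → Dec (P r)) {_ : True (all? (λ (i : Fin 7) → P? (toℕ i)))} →
                ∀ r → r < 7 → P r
by-evaluation {P} P? {ok} r r<7 = subst P (toℕ-fromℕ< r<7) (toWitness ok (fromℕ< r<7))

by-evaluation₂ : ∀ {P : ℕ → ℕ → Set} (P? : ∀ r s → Dec (P r s))
                 {_ : True (all? (λ (i : Fin 7) → all? (λ (j : Fin 7) → P? (toℕ i) (toℕ j))))} →
                 ∀ r s → r < 7 → s < 7 → P r s
by-evaluation₂ {P} P? {ok} r s r<7 s<7 =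
  subst₂ P (toℕ-fromℕ< r<7) (toℕ-fromℕ< s<7) (toWitness ok (fromℕ< r<7) (fromℕ< s<7))

periodic-% : ∀ {A : Set} k .{{_ : NonZero k}} (f : ℕ → A) → (∀ u → f (k + u) ≡ f u) → ∀ u → f u ≡ f (u % k)
periodic-% k f per u = trans (cong f (m≡m%n+[m/n]*n u k)) (multiples (u / k) (u % k))
  where
  multiples : ∀ q r → f (r + q * k) ≡ f r
  multiples zero    r = cong f (+-identityʳ r)
  multiples (suc q) r = trans (cong f (x∙yz≈y∙xz r k (q * k))) (trans (per (r + q * k)) (multiples q r))

-- 7 ∣ 3n implies 7 ∣ n, because 5 · 3n = 7 · 2n + n.
7∣3n⇒7∣n : ∀ n → 7 ∣ 3 * n → 7 ∣ n
7∣3n⇒7∣n n h = ∣m+n∣m⇒∣n (subst (7 ∣_) (fifteen n) (∣n⇒∣m*n 5 h)) (∣m⇒∣m*n (2 * n) ∣-refl)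
  where
  fifteen : ∀ n → 5 * (3 * n) ≡ 7 * (2 * n) + n
  fifteen = solve-∀

data Dir : Set where
  east west north south southeast northwest : Dir

-- On the torus V (suc m') (suc n') adding m' (resp. n') to a coordinate subtracts one.
move : ∀ {m' n'} → Dir → V (suc m') (suc n') → V (suc m') (suc n')
move {m'} {n'} east      (i , j) = (shift i 1  , j)
move {m'} {n'} west      (i , j) = (shift i m' , j)
move {m'} {n'} north     (i , j) = (i , shift j 1)
move {m'} {n'} south     (i , j) = (i , shift j n')
move {m'} {n'} southeast (i , j) = (shift i 1  , shift j n')
move {m'} {n'} northwest (i , j) = (shift i m' , shift j 1)

move-adjacent : ∀ {m' n'} d (v : V (suc m') (suc n')) → Adj v (move d v)
move-adjacent east      (i , j) = inj₁ refl
move-adjacent west      (i , j) = inj₂ (inj₁ refl)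
move-adjacent north     (i , j) = inj₂ (inj₂ (inj₁ refl))
move-adjacent south     (i , j) = inj₂ (inj₂ (inj₂ (inj₁ refl)))
move-adjacent southeast (i , j) = inj₂ (inj₂ (inj₂ (inj₂ (inj₁ refl))))
move-adjacent northwest (i , j) = inj₂ (inj₂ (inj₂ (inj₂ (inj₂ refl))))

adjacent-move : ∀ {m' n'} (v u : V (suc m') (suc n')) → Adj v u → ∃[ d ] u ≡ move d v
adjacent-move (i , j) u (inj₁ e)                                   = east , e
adjacent-move (i , j) u (inj₂ (inj₁ e))                            = west , e
adjacent-move (i , j) u (inj₂ (inj₂ (inj₁ e)))                     = north , e
adjacent-move (i , j) u (inj₂ (inj₂ (inj₂ (inj₁ e))))              = south , e
adjacent-move (i , j) u (inj₂ (inj₂ (inj₂ (inj₂ (inj₁ e)))))       = southeast , e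
adjacent-move (i , j) u (inj₂ (inj₂ (inj₂ (inj₂ (inj₂ e)))))       = northwest , e

module PerfectCodes {m' n'} (c : V (suc m') (suc n') → Fin 7) (H : SevenCodePartition c) where

  independent : ∀ u v → Adj u v → c u ≢ c v
  independent u v adj e = proj₁ (H (c u)) u v refl (sym e) adj

  dominated : ∀ w k → c w ≢ k → ∃[ u ] c u ≡ k × Adj w u
  dominated w k ne = proj₁ (proj₂ (H k) w ne)

  unique-dominator : ∀ w u v → Adj w u → Adj w v → c u ≡ c v → u ≡ v
  unique-dominator w u v wu wv e =
    proj₂ (proj₂ (H (c u)) w (independent w u wu)) u v refl wu (sym e) wv

-- Offsets of the directions, increased by one so that they are natural numbers.
Δx Δy : Dir → ℕ
Δx east = 2
Δx west = 0
Δx north = 1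
Δx south = 1
Δx southeast = 2
Δx northwest = 0
Δy east = 1
Δy west = 1
Δy north = 2
Δy south = 0
Δy southeast = 0
Δy northwest = 2

-- Offsets stay below 3, hence below the side lengths of a torus that is at least 3 × 3.
Δx<3 : ∀ d → Δx d < 3
Δx<3 east = s≤s (s≤s (s≤s z≤n))
Δx<3 west = s≤s z≤n
Δx<3 north = s≤s (s≤s z≤n)
Δx<3 south = s≤s (s≤s z≤n)
Δx<3 southeast = s≤s (s≤s (s≤s z≤n))
Δx<3 northwest = s≤s z≤n

Δy<3 : ∀ d → Δy d < 3
Δy<3 east = s≤s (s≤s z≤n)
Δy<3 west = s≤s (s≤s z≤n)
Δy<3 north = s≤s (s≤s (s≤s z≤n))
Δy<3 south = s≤s z≤n
Δy<3 southeast = s≤s z≤n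
Δy<3 northwest = s≤s (s≤s (s≤s z≤n))

fromOffset : ℕ → ℕ → Dir
fromOffset 2 1 = east
fromOffset 0 1 = west
fromOffset 1 2 = north
fromOffset 1 0 = south
fromOffset 2 0 = southeast
fromOffset _ _ = northwest

fromOffset-Δ : ∀ d → fromOffset (Δx d) (Δy d) ≡ d
fromOffset-Δ east = refl
fromOffset-Δ west = refl
fromOffset-Δ north = refl
fromOffset-Δ south = refl
fromOffset-Δ southeast = refl
fromOffset-Δ northwest = refl

Δ-injective : ∀ {d d'} → Δx d ≡ Δx d' → Δy d ≡ Δy d' → d ≡ d'
Δ-injective {d} {d'} ex ey =
  trans (sym (fromOffset-Δ d)) (trans (cong₂ fromOffset ex ey) (fromOffset-Δ d'))

data Nbr : Set where
  centre : Nbr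
  step   : Dir → Nbr

-- The closed neighbourhood of the point (x , y), x, y ≥ 1, of the quarter plane ℕ × ℕ.
around : ℕ → ℕ → Nbr → ℕ × ℕ
around x y centre   = (x , y)
around x y (step d) = (Δx d + pred x , Δy d + pred y)

Colouring : Set
Colouring = ℕ × ℕ → Fin 7

_ᵀ : Colouring → Colouring
(C ᵀ) p = C (swap p)

record Rainbow (C : Colouring) (x y : ℕ) : Set where
  field
    injective  : ∀ d d' → C (around x y d) ≡ C (around x y d') → d ≡ d'
    surjective : ∀ k → ∃[ d ] C (around x y d) ≡ k

mirror : Nbr → Nbr
mirror centre = centre
mirror (step east) = step north
mirror (step west) = step south
mirror (step north) = step east
mirror (step south) = step west
mirror (step southeast) = step northwest
mirror (step northwest) = step southeast

mirror-involutive : ∀ d → mirror (mirror d) ≡ d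
mirror-involutive centre = refl
mirror-involutive (step east) = refl
mirror-involutive (step west) = refl
mirror-involutive (step north) = refl
mirror-involutive (step south) = refl
mirror-involutive (step southeast) = refl
mirror-involutive (step northwest) = refl

swap-around : ∀ x y d → swap (around x y d) ≡ around y x (mirror d)
swap-around x y centre = refl
swap-around x y (step east) = refl
swap-around x y (step west) = refl
swap-around x y (step north) = refl
swap-around x y (step south) = refl
swap-around x y (step southeast) = refl
swap-around x y (step northwest) = refl

rainbow-ᵀ : ∀ {C x y} → Rainbow C y x → Rainbow (C ᵀ) x y
rainbow-ᵀ {C} {x} {y} R = record
  { injective  = λ d d' e → trans (sym (mirror-involutive d))
      (trans (cong mirror (Rainbow.injective R (mirror d) (mirror d') (trans (sym (colour d)) (trans e (colour d')))))
             (mirror-involutive d'))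
  ; surjective = λ k → let (d , e) = Rainbow.surjective R k in
      mirror d , trans (colour (mirror d)) (trans (cong (λ d' → C (around y x d')) (mirror-involutive d)) e)
  }
  where
  colour : ∀ d → (C ᵀ) (around x y d) ≡ C (around y x (mirror d))
  colour d = cong C (swap-around x y d)

module Lift {m' n'} (c : V (suc m') (suc n') → Fin 7) where

  point : ℕ × ℕ → V (suc m') (suc n')
  point (x , y) = (residue (suc m') x , residue (suc n') y)

  lift : Colouring
  lift p = c (point p)

  lift-periodicˣ : ∀ x y → lift (suc m' + x , y) ≡ lift (x , y)
  lift-periodicˣ x y = cong (λ i → c (i , residue (suc n') y)) (residue-periodic (suc m') x)

  lift-periodicʸ : ∀ x y → lift (x , suc n' + y) ≡ lift (x , y)
  lift-periodicʸ x y = cong (λ j → c (residue (suc m') x , j)) (residue-periodic (suc n') y)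

  forward : ∀ k x → shift (residue (suc k) x) 1 ≡ residue (suc k) (suc x)
  forward k x = trans (shift-residue (suc k) x 1) (cong (residue (suc k)) (+-comm x 1))

  backward : ∀ k x → shift (residue (suc k) (suc x)) k ≡ residue (suc k) x
  backward k x = trans (shift-residue (suc k) (suc x) k)
                       (trans (cong (λ z → residue (suc k) (suc z)) (+-comm x k)) (residue-periodic (suc k) x))

  point-step : ∀ x y d → point (around (suc x) (suc y) (step d)) ≡ move d (point (suc x , suc y))
  point-step x y east      = cong₂ _,_ (sym (forward m' (suc x))) refl
  point-step x y west      = cong₂ _,_ (sym (backward m' x)) refl
  point-step x y north     = cong₂ _,_ refl (sym (forward n' (suc y)))
  point-step x y south     = cong₂ _,_ refl (sym (backward n' y))
  point-step x y southeast = cong₂ _,_ (sym (forward m' (suc x))) (sym (backward n' y))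
  point-step x y northwest = cong₂ _,_ (sym (backward m' x)) (sym (forward n' (suc y)))

  lift-rainbow : SevenCodePartition c → 3 ≤ suc m' → 3 ≤ suc n' → ∀ x y → Rainbow lift (suc x) (suc y)
  lift-rainbow H 3≤m 3≤n x y = record { injective = injective ; surjective = surjective }
    where
    open PerfectCodes c H
    w : V (suc m') (suc n')
    w = point (suc x , suc y)

    colour-step : ∀ d → lift (around (suc x) (suc y) (step d)) ≡ c (move d w)
    colour-step d = cong c (point-step x y d)

    injective : ∀ d d' → lift (around (suc x) (suc y) d) ≡ lift (around (suc x) (suc y) d') → d ≡ d'
    injective centre   centre    e = refl
    injective centre   (step d)  e = ⊥-elim (independent w (move d w) (move-adjacent d w) (trans e (colour-step d)))
    injective (step d) centre    e = ⊥-elim (independent w (move d w) (move-adjacent d w) (trans (sym e) (colour-step d)))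
    injective (step d) (step d') e = cong step (Δ-injective
        (residue-cancel (suc m') x (<-≤-trans (Δx<3 d) 3≤m) (<-≤-trans (Δx<3 d') 3≤m) (cong proj₁ same-point))
        (residue-cancel (suc n') y (<-≤-trans (Δy<3 d) 3≤n) (<-≤-trans (Δy<3 d') 3≤n) (cong proj₂ same-point)))
      where
      same-point : point (around (suc x) (suc y) (step d)) ≡ point (around (suc x) (suc y) (step d'))
      same-point = trans (point-step x y d) (trans
        (unique-dominator w _ _ (move-adjacent d w) (move-adjacent d' w)
          (trans (sym (colour-step d)) (trans e (colour-step d'))))
        (sym (point-step x y d')))

    surjective : ∀ k → ∃[ d ] lift (around (suc x) (suc y) d) ≡ k
    surjective k with c w ≟ k
    ... | yes e = centre , e
    ... | no ne = let (u , cu , adj) = dominated w k ne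
                      (d , u≡) = adjacent-move w u adj
                  in step d , trans (colour-step d) (trans (cong c (sym u≡)) cu)

ChiralA ChiralB : Colouring → ℕ → ℕ → Set
ChiralA C x y = C (1 + x , 2 + y) ≡ C (x , y)
ChiralB C x y = C (2 + x , 1 + y) ≡ C (x , y)

TypeA : Colouring → Set
TypeA C = ∀ a b → ChiralA C (3 + a) (3 + b)

-- Each lemma is a case analysis over the closed neighbourhood of one point: every
-- candidate but the claimed one shares a closed neighbourhood with a point of the same colour.
module Rigidity (C : Colouring) (R : ∀ x y → Rainbow C (suc x) (suc y)) where

  nbhd : ∀ x y .{{_ : NonZero x}} .{{_ : NonZero y}} → Rainbow C x y
  nbhd (suc x) (suc y) = R x y

  apart : ∀ x y .{{_ : NonZero x}} .{{_ : NonZero y}} d d' {k} → d ≢ d' →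
          C (around x y d) ≡ k → C (around x y d') ≡ k → ⊥
  apart x y d d' d≢d' e e' = d≢d' (Rainbow.injective (nbhd x y) d d' (trans e (sym e')))

  meets : ∀ x y .{{_ : NonZero x}} .{{_ : NonZero y}} k → ∃[ d ] C (around x y d) ≡ k
  meets x y = Rainbow.surjective (nbhd x y)

  -- The point p + (1,1) must see the colour of p; apart from p + (1,2) and p + (2,1)
  -- all its closed neighbours lie within distance two of p.
  chirality : ∀ x y → ChiralA C (suc x) (suc y) ⊎ ChiralB C (suc x) (suc y)
  chirality x y = seen (meets (2 + x) (2 + y) (C (suc x , suc y)))
    where
    seen : ∃[ d ] C (around (2 + x) (2 + y) d) ≡ C (suc x , suc y) →
           ChiralA C (suc x) (suc y) ⊎ ChiralB C (suc x) (suc y)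
    seen (centre , e)          = ⊥-elim (apart (1 + x) (2 + y) (step east) (step south) (λ ()) e refl)
    seen (step east , e)       = inj₂ e
    seen (step west , e)       = ⊥-elim (apart (1 + x) (1 + y) (step north) centre (λ ()) e refl)
    seen (step north , e)      = inj₁ e
    seen (step south , e)      = ⊥-elim (apart (1 + x) (1 + y) (step east) centre (λ ()) e refl)
    seen (step southeast , e)  = ⊥-elim (apart (2 + x) (1 + y) (step east) (step west) (λ ()) e refl)
    seen (step northwest , e)  = ⊥-elim (apart (1 + x) (2 + y) (step north) (step south) (λ ()) e refl)

  -- If the class of p contains p + (1,2), then p + (2,0) can only see that colour at p + (3,-1).
  continuation : ∀ x y → ChiralA C (suc x) (suc y) → C (4 + x , y) ≡ C (suc x , suc y)
  continuation x y a = seen (meets (3 + x) (1 + y) (C (suc x , suc y)))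
    where
    seen : ∃[ d ] C (around (3 + x) (1 + y) d) ≡ C (suc x , suc y) → C (4 + x , y) ≡ C (suc x , suc y)
    seen (centre , e)          = ⊥-elim (apart (2 + x) (1 + y) (step east) (step west) (λ ()) e refl)
    seen (step east , e)       = ⊥-elim (apart (3 + x) (2 + y) (step southeast) (step northwest) (λ ()) e a)
    seen (step west , e)       = ⊥-elim (apart (1 + x) (1 + y) (step east) centre (λ ()) e refl)
    seen (step north , e)      = ⊥-elim (apart (2 + x) (3 + y) (step southeast) centre (λ ()) e a)
    seen (step south , e)      = ⊥-elim (apart (2 + x) (1 + y) (step southeast) (step west) (λ ()) e refl)
    seen (step southeast , e)  = e
    seen (step northwest , e)  = ⊥-elim (apart (1 + x) (2 + y) (step east) (step south) (λ ()) e refl)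

  -- Chirality A propagates northwards: were q = p + (0,1) of chirality B, the point p + (2,0)
  -- would not see the colour of q.
  northward : ∀ x y → ChiralA C (suc x) (suc y) → ChiralA C (suc x) (2 + y)
  northward x y a with chirality x (suc y)
  ... | inj₁ a-q = a-q
  ... | inj₂ b   = ⊥-elim (unseen (meets (3 + x) (1 + y) (C (suc x , 2 + y))))
    where
    a′ : C (4 + x , y) ≡ C (suc x , suc y)
    a′ = continuation x y a
    unseen : ∃[ d ] C (around (3 + x) (1 + y) d) ≡ C (suc x , 2 + y) → ⊥
    unseen (centre , e)          = apart (2 + x) (2 + y) (step southeast) (step west) (λ ()) e refl
    unseen (step east , e)       = apart (4 + x) (2 + y) (step south) (step northwest) (λ ()) e b
    unseen (step west , e)       = apart (1 + x) (2 + y) (step southeast) centre (λ ()) e refl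
    unseen (step north , e)      = apart (2 + x) (2 + y) (step east) (step west) (λ ()) e refl
    unseen (step south , e)      = apart (2 + x) (1 + y) (step southeast) (step northwest) (λ ()) e refl
    unseen (step southeast , e)  = apart (1 + x) (1 + y) centre (step north) (λ ()) (trans (sym a′) e) refl
    unseen (step northwest , e)  = apart (1 + x) (2 + y) (step east) centre (λ ()) e refl

  -- Chirality A propagates eastwards: were q = p + (1,0) of chirality B, the colour of p would
  -- be forced at p + (2,-3), then that of q at p + (3,-3), and p + (3,-1) would not see the
  -- colour of q.
  eastward : ∀ x y → ChiralA C (suc x) (3 + y) → ChiralA C (2 + x) (3 + y)
  eastward x y a with chirality (suc x) (2 + y)
  ... | inj₁ a-q = a-q
  ... | inj₂ b   = ⊥-elim (unseen (meets (4 + x) (2 + y) (C (2 + x , 3 + y))))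
    where
    a′ : C (4 + x , 2 + y) ≡ C (suc x , 3 + y)
    a′ = continuation x (2 + y) a
    p≢q : C (suc x , 3 + y) ≡ C (2 + x , 3 + y) → ⊥
    p≢q e = apart (1 + x) (3 + y) centre (step east) (λ ()) e refl

    k₁ : C (3 + x , y) ≡ C (suc x , 3 + y)
    k₁ = seen (meets (3 + x) (1 + y) (C (suc x , 3 + y)))
      where
      seen : ∃[ d ] C (around (3 + x) (1 + y) d) ≡ C (suc x , 3 + y) → C (3 + x , y) ≡ C (suc x , 3 + y)
      seen (centre , e)          = ⊥-elim (apart (2 + x) (2 + y) (step southeast) (step northwest) (λ ()) e refl)
      seen (step east , e)       = ⊥-elim (apart (4 + x) (2 + y) (step south) centre (λ ()) e a′)
      seen (step west , e)       = ⊥-elim (apart (2 + x) (2 + y) (step south) (step northwest) (λ ()) e refl)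
      seen (step north , e)      = ⊥-elim (apart (2 + x) (3 + y) (step southeast) (step west) (λ ()) e refl)
      seen (step south , e)      = e
      seen (step southeast , e)  = ⊥-elim (apart (4 + x) (1 + y) (step south) (step north) (λ ()) e a′)
      seen (step northwest , e)  = ⊥-elim (apart (1 + x) (3 + y) (step southeast) centre (λ ()) e refl)

    j₁ : C (4 + x , y) ≡ C (2 + x , 3 + y)
    j₁ = seen (meets (3 + x) (1 + y) (C (2 + x , 3 + y)))
      where
      seen : ∃[ d ] C (around (3 + x) (1 + y) d) ≡ C (2 + x , 3 + y) → C (4 + x , y) ≡ C (2 + x , 3 + y)
      seen (centre , e)          = ⊥-elim (apart (3 + x) (2 + y) (step south) (step northwest) (λ ()) e refl)
      seen (step east , e)       = ⊥-elim (apart (3 + x) (2 + y) (step southeast) (step northwest) (λ ()) e refl)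
      seen (step west , e)       = ⊥-elim (apart (2 + x) (2 + y) (step south) (step north) (λ ()) e refl)
      seen (step north , e)      = ⊥-elim (apart (2 + x) (3 + y) (step southeast) centre (λ ()) e refl)
      seen (step south , e)      = ⊥-elim (p≢q (trans (sym k₁) e))
      seen (step southeast , e)  = e
      seen (step northwest , e)  = ⊥-elim (apart (2 + x) (3 + y) (step south) centre (λ ()) e refl)

    unseen : ∃[ d ] C (around (4 + x) (2 + y) d) ≡ C (2 + x , 3 + y) → ⊥
    unseen (centre , e)          = p≢q (trans (sym a′) e)
    unseen (step east , e)       = apart (5 + x) (3 + y) (step south) (step northwest) (λ ()) e b
    unseen (step west , e)       = apart (2 + x) (3 + y) (step southeast) centre (λ ()) e refl
    unseen (step north , e)      = apart (3 + x) (3 + y) (step east) (step west) (λ ()) e refl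
    unseen (step south , e)      = apart (3 + x) (2 + y) (step southeast) (step northwest) (λ ()) e refl
    unseen (step southeast , e)  = apart (4 + x) (1 + y) (step east) (step south) (λ ()) e j₁
    unseen (step northwest , e)  = apart (2 + x) (3 + y) (step east) centre (λ ()) e refl

  spread : ChiralA C 3 3 → TypeA C
  spread a₀ a b = northwards b (eastwards a)
    where
    eastwards : ∀ a → ChiralA C (3 + a) 3
    eastwards zero    = a₀
    eastwards (suc a) = eastward (2 + a) 0 (eastwards a)
    northwards : ∀ b → ChiralA C (3 + a) 3 → ChiralA C (3 + a) (3 + b)
    northwards zero    h = h
    northwards (suc b) h = northward (2 + a) (2 + b) (northwards b h)

rigidity : ∀ C → (∀ x y → Rainbow C (suc x) (suc y)) → TypeA C ⊎ TypeA (C ᵀ)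
rigidity C R with Rigidity.chirality C R 2 2
... | inj₁ a = inj₁ (Rigidity.spread C R a)
... | inj₂ b = inj₂ (Rigidity.spread (C ᵀ) (λ x y → rainbow-ᵀ (R y x)) b)

data Kind : Set where
  A B : Kind

lin : Kind → ℕ → ℕ → ℕ
lin A x y = (x + 3 * y) % 7
lin B x y = lin A y x

lin<7 : ∀ t x y → lin t x y < 7
lin<7 A x y = m%n<n (x + 3 * y) 7
lin<7 B x y = m%n<n (y + 3 * x) 7

lin-cong : ∀ t {x x' y y'} → x % 7 ≡ x' % 7 → y % 7 ≡ y' % 7 → lin t x y ≡ lin t x' y'
lin-cong A {x} {x'} {y} {y'} ex ey = %-cong-+ 7 {x} {x'} {3 * y} {3 * y'} ex (%-congˡ-* 7 3 {y} {y'} ey)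
lin-cong B {x} {x'} {y} {y'} ex ey = lin-cong A {y} {y'} {x} {x'} ey ex

Δlin : Kind → ℕ → ℕ → ℕ
Δlin A a b = a + 3 * b
Δlin B a b = Δlin A b a

lin-+ : ∀ t x y a b → lin t (x + a) (y + b) ≡ (Δlin t a b + lin t x y) % 7
lin-+ A x y a b = begin
  (x + a + 3 * (y + b)) % 7            ≡⟨ cong (_% 7) (regroup x y a b) ⟩
  (a + 3 * b + (x + 3 * y)) % 7        ≡⟨ %-cong-+ 7 {a + 3 * b} {a + 3 * b} {x + 3 * y} {lin A x y} refl (sym (m%n%n≡m%n (x + 3 * y) 7)) ⟩
  (a + 3 * b + lin A x y) % 7          ∎
  where
  regroup : ∀ x y a b → x + a + 3 * (y + b) ≡ a + 3 * b + (x + 3 * y)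
  regroup = solve-∀
lin-+ B x y a b = lin-+ A y x b a

record Linear (C : Colouring) (m n : ℕ) : Set where
  field
    kind : Kind
    label : ℕ → Fin 7
    factor : ∀ x y → C (x , y) ≡ label (lin kind x y)
    label-injective : ∀ r s → r < 7 → s < 7 → label r ≡ label s → r ≡ s
    label-surjective : ∀ k → ∃[ r ] r < 7 × label r ≡ k
    7∣m : 7 ∣ m
    7∣n : 7 ∣ n

module LinearityA (C : Colouring) (m₃ n₃ : ℕ)
  (periodicˣ : ∀ x y → C (3 + m₃ + x , y) ≡ C (x , y))
  (periodicʸ : ∀ x y → C (x , 3 + n₃ + y) ≡ C (x , y))
  (R : ∀ x y → Rainbow C (suc x) (suc y)) (typeA : TypeA C) where

  open Rigidity C R using (continuation)

  periodic : ∀ x y → C (3 + m₃ + x , 3 + n₃ + y) ≡ C (x , y)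
  periodic x y = trans (periodicˣ x _) (periodicʸ x y)

  -- Translation by (1,2) preserves colours everywhere: move the point beyond (3,3) first.
  along-1-2 : ∀ x y → C (1 + x , 2 + y) ≡ C (x , y)
  along-1-2 x y = begin
    C (1 + x , 2 + y)                        ≡⟨ periodic (1 + x) (2 + y) ⟨
    C (3 + m₃ + (1 + x) , 3 + n₃ + (2 + y))  ≡⟨ cong₂ (λ u v → C (u , v)) (x∙yz≈y∙xz (3 + m₃) 1 x) (x∙yz≈y∙xz (3 + n₃) 2 y) ⟩
    C (1 + (3 + m₃ + x) , 2 + (3 + n₃ + y))  ≡⟨ typeA (m₃ + x) (n₃ + y) ⟩
    C (3 + m₃ + x , 3 + n₃ + y)              ≡⟨ periodic x y ⟩
    C (x , y)                                ∎

  along-3-1 : ∀ x y → C (3 + x , y) ≡ C (x , 1 + y)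
  along-3-1 x y = begin
    C (3 + x , y)                            ≡⟨ periodic (3 + x) y ⟨
    C (3 + m₃ + (3 + x) , 3 + n₃ + y)        ≡⟨ cong (λ u → C (u , 3 + n₃ + y)) (x∙yz≈y∙xz (3 + m₃) 3 x) ⟩
    C (3 + (3 + m₃ + x) , 3 + n₃ + y)        ≡⟨ continuation (2 + (m₃ + x)) (3 + (n₃ + y)) (typeA (m₃ + x) (1 + (n₃ + y))) ⟩
    C (3 + m₃ + x , 1 + (3 + n₃ + y))        ≡⟨ cong (λ v → C (3 + m₃ + x , v)) (x∙yz≈y∙xz 1 (3 + n₃) y) ⟩
    C (3 + m₃ + x , 3 + n₃ + (1 + y))        ≡⟨ periodic x (1 + y) ⟩
    C (x , 1 + y)                            ∎

  to-axis : ∀ x y → C (x , y) ≡ C (x + 3 * y , 0)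
  to-axis x zero    = cong (λ u → C (u , 0)) (sym (+-identityʳ x))
  to-axis x (suc y) = trans (sym (along-3-1 x y)) (trans (to-axis (3 + x) y) (cong (λ u → C (u , 0)) (shear x y)))
    where
    shear : ∀ x y → 3 + x + 3 * y ≡ x + 3 * suc y
    shear = solve-∀

  -- … and colours along the axis have period 7, since (7,0) = 2·(3,-1) + (1,2).
  axis-period : ∀ u → C (7 + u , 0) ≡ C (u , 0)
  axis-period u = trans (along-3-1 (4 + u) 0) (trans (along-3-1 (1 + u) 1) (along-1-2 u 0))

  label : ℕ → Fin 7
  label r = C (r , 0)

  factor : ∀ x y → C (x , y) ≡ label (lin A x y)
  factor x y = trans (to-axis x y) (periodic-% 7 label axis-period (x + 3 * y))

  -- The closed neighbourhood of (1,1) realises each residue exactly once.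
  site : ℕ → Nbr
  site 0 = step north
  site 1 = step south
  site 2 = step southeast
  site 3 = step west
  site 4 = centre
  site 5 = step east
  site _ = step northwest

  lin-at : ℕ × ℕ → ℕ
  lin-at (x , y) = lin A x y

  factor-at : ∀ p → C p ≡ label (lin-at p)
  factor-at (x , y) = factor x y

  lin-at<7 : ∀ p → lin-at p < 7
  lin-at<7 (x , y) = lin<7 A x y

  lin-around : Nbr → ℕ
  lin-around d = lin-at (around 1 1 d)

  lin-site : ∀ r → r < 7 → lin-around (site r) ≡ r
  lin-site = by-evaluation (λ r → lin-around (site r) ℕ.≟ r)

  colour-site : ∀ r → r < 7 → C (around 1 1 (site r)) ≡ label r
  colour-site r r<7 = trans (factor-at (around 1 1 (site r))) (cong label (lin-site r r<7))

  label-injective : ∀ r s → r < 7 → s < 7 → label r ≡ label s → r ≡ s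
  label-injective r s r<7 s<7 e = begin
    r                      ≡⟨ lin-site r r<7 ⟨
    lin-around (site r)    ≡⟨ cong lin-around same-site ⟩
    lin-around (site s)    ≡⟨ lin-site s s<7 ⟩
    s                      ∎
    where
    same-site : site r ≡ site s
    same-site = Rainbow.injective (R 0 0) (site r) (site s)
                  (trans (colour-site r r<7) (trans e (sym (colour-site s s<7))))

  label-surjective : ∀ k → ∃[ r ] r < 7 × label r ≡ k
  label-surjective k = let (d , e) = Rainbow.surjective (R 0 0) k in
    lin-around d , lin-at<7 (around 1 1 d) , trans (sym (factor-at (around 1 1 d))) e

  -- A point coloured like the origin sits at residue 0; applied to the periods this gives 7 ∣ m, n.
  like-origin : ∀ x y → C (x , y) ≡ C (0 , 0) → 7 ∣ x + 3 * y
  like-origin x y e = m%n≡0⇒n∣m _ 7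
    (label-injective (lin A x y) 0 (lin<7 A x y) (s≤s z≤n) (trans (sym (factor x y)) (trans e (factor 0 0))))

  linear : Linear C (3 + m₃) (3 + n₃)
  linear = record
    { kind = A ; label = label ; factor = factor
    ; label-injective = label-injective ; label-surjective = label-surjective
    ; 7∣m = subst (7 ∣_) (trans (+-identityʳ _) (+-identityʳ _)) (like-origin (3 + m₃ + 0) 0 (periodicˣ 0 0))
    ; 7∣n = 7∣3n⇒7∣n _ (subst (λ w → 7 ∣ 3 * w) (+-identityʳ (3 + n₃)) (like-origin 0 (3 + n₃ + 0) (periodicʸ 0 0)))
    }

transposeᴷ : Kind → Kind
transposeᴷ A = B
transposeᴷ B = A

lin-transpose : ∀ t x y → lin t y x ≡ lin (transposeᴷ t) x y
lin-transpose A x y = refl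
lin-transpose B x y = refl

linear-ᵀ : ∀ {C m n} → Linear (C ᵀ) n m → Linear C m n
linear-ᵀ L = record
  { kind = transposeᴷ kind ; label = label
  ; factor = λ x y → trans (factor y x) (cong label (lin-transpose kind x y))
  ; label-injective = label-injective ; label-surjective = label-surjective
  ; 7∣m = 7∣n ; 7∣n = 7∣m }
  where open Linear L

linearity : ∀ C m₃ n₃ → (∀ x y → C (3 + m₃ + x , y) ≡ C (x , y)) → (∀ x y → C (x , 3 + n₃ + y) ≡ C (x , y)) →
            (∀ x y → Rainbow C (suc x) (suc y)) → Linear C (3 + m₃) (3 + n₃)
linearity C m₃ n₃ perˣ perʸ R with rigidity C R
... | inj₁ a = LinearityA.linear C m₃ n₃ perˣ perʸ R a
... | inj₂ b = linear-ᵀ (LinearityA.linear (C ᵀ) n₃ m₃ (λ x y → perʸ y x) (λ x y → perˣ y x)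
                                          (λ x y → rainbow-ᵀ (R y x)) b)

linᵛ : ∀ {m n} → Kind → V m n → ℕ
linᵛ t (i , j) = lin t (toℕ i) (toℕ j)

toℕ-shift : ∀ {k} .{{_ : NonZero k}} → 7 ∣ k → ∀ (i : Fin k) e → toℕ (shift i e) % 7 ≡ (toℕ i + e) % 7
toℕ-shift {k} 7∣k i e = trans (cong (_% 7) (toℕ-residue k (toℕ i + e))) (m∣n⇒o%n%m≡o%m 7 k (toℕ i + e) 7∣k)

lin-shift : ∀ {m n} .{{_ : NonZero m}} .{{_ : NonZero n}} → 7 ∣ m → 7 ∣ n →
            ∀ t (i : Fin m) (j : Fin n) a b → linᵛ t (shift i a , shift j b) ≡ (Δlin t a b + linᵛ t (i , j)) % 7
lin-shift 7∣m 7∣n t i j a b = trans (lin-cong t {toℕ (shift i a)} {toℕ i + a} {toℕ (shift j b)} {toℕ j + b} (toℕ-shift 7∣m i a) (toℕ-shift 7∣n j b)) (lin-+ t (toℕ i) (toℕ j) a b)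

count : ℕ → (ℕ → Bool) → ℕ
count zero    h = 0
count (suc n) h = (if h 0 then 1 else 0) + count n (λ y → h (suc y))

count-cong : ∀ n {h h'} → (∀ y → h y ≡ h' y) → count n h ≡ count n h'
count-cong zero    e = refl
count-cong (suc n) e = cong₂ (λ b c → (if b then 1 else 0) + c) (e 0) (count-cong n (λ y → e (suc y)))

count-+ : ∀ a b h → count (a + b) h ≡ count a h + count b (λ y → h (a + y))
count-+ zero    b h = refl
count-+ (suc a) b h = trans (cong ((if h 0 then 1 else 0) +_) (count-+ a b (λ y → h (suc y))))
                            (sym (+-assoc (if h 0 then 1 else 0) _ _))

count-periodic : ∀ k q h → (∀ y → h (k + y) ≡ h y) → count (q * k) h ≡ q * count k h
count-periodic k zero    h per = refl
count-periodic k (suc q) h per =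
  trans (count-+ k (q * k) h) (cong (count k h +_) (trans (count-cong (q * k) per) (count-periodic k q h per)))

length-filter-tabulate : ∀ {A : Set} {P : A → Set} (P? : Decidable P) {n} (f : Fin n → A) (h : ℕ → Bool) →
                         (∀ j → does (P? (f j)) ≡ h (toℕ j)) → length (filter P? (tabulate f)) ≡ count n h
length-filter-tabulate P? {zero}  f h agree = refl
length-filter-tabulate P? {suc n} f h agree with does (P? (f Fin.zero)) | h 0 | agree Fin.zero
... | true  | true  | _ = cong suc (length-filter-tabulate P? (λ j → f (Fin.suc j)) (λ y → h (suc y)) (λ j → agree (Fin.suc j)))
... | false | false | _ = length-filter-tabulate P? (λ j → f (Fin.suc j)) (λ y → h (suc y)) (λ j → agree (Fin.suc j))

length-filter-product : ∀ {A B : Set} {P : A × B → Set} (P? : Decidable P) (xs : List A) (ys : List B) q →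
                        (∀ x → length (filter P? (map (x ,_) ys)) ≡ q) →
                        length (filter P? (cartesianProduct xs ys)) ≡ length xs * q
length-filter-product P? []       ys q row = refl
length-filter-product P? (x ∷ xs) ys q row = begin
  length (filter P? (map (x ,_) ys ++ cartesianProduct xs ys))
    ≡⟨ cong length (filter-++ P? (map (x ,_) ys) (cartesianProduct xs ys)) ⟩
  length (filter P? (map (x ,_) ys) ++ filter P? (cartesianProduct xs ys))
    ≡⟨ length-++ (filter P? (map (x ,_) ys)) ⟩
  length (filter P? (map (x ,_) ys)) + length (filter P? (cartesianProduct xs ys))
    ≡⟨ cong₂ _+_ (row x) (length-filter-product P? xs ys q row) ⟩
  q + length xs * q  ∎

once-per-period : ∀ t s r → s < 7 → r < 7 → count 7 (λ y → does (lin t s y ℕ.≟ r)) ≡ 1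
once-per-period A = by-evaluation₂ (λ s r → count 7 (λ y → does (lin A s y ℕ.≟ r)) ℕ.≟ 1)
once-per-period B = by-evaluation₂ (λ s r → count 7 (λ y → does (lin B s y ℕ.≟ r)) ℕ.≟ 1)

vertical-shift : ∀ t r₀ r → r₀ < 7 → r < 7 → ∃[ b ] (Δlin t 0 b + r₀) % 7 ≡ r
vertical-shift t r₀ r r₀<7 r<7 = let (b , e) = search t r₀ r r₀<7 r<7 in toℕ b , e
  where
  search : ∀ t r₀ r → r₀ < 7 → r < 7 → ∃[ b ] (Δlin t 0 (toℕ {7} b) + r₀) % 7 ≡ r
  search A = by-evaluation₂ (λ r₀ r → any? (λ b → (Δlin A 0 (toℕ b) + r₀) % 7 ℕ.≟ r))
  search B = by-evaluation₂ (λ r₀ r → any? (λ b → (Δlin B 0 (toℕ b) + r₀) % 7 ℕ.≟ r))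

module Classes {m' n'} (c : V (suc m') (suc n') → Fin 7) (L : Linear (Lift.lift c) (suc m') (suc n')) where
  open Linear L

  colour-lin : ∀ v → c v ≡ label (linᵛ kind v)
  colour-lin (i , j) = trans (cong c (sym (cong₂ _,_ (residue-toℕ (suc m') i) (residue-toℕ (suc n') j))))
                             (factor (toℕ i) (toℕ j))

  rank : Fin 7 → ℕ
  rank k = proj₁ (label-surjective k)

  rank<7 : ∀ k → rank k < 7
  rank<7 k = proj₁ (proj₂ (label-surjective k))

  member⇒ : ∀ v k → c v ≡ k → linᵛ kind v ≡ rank k
  member⇒ v k cv = label-injective _ _ (lin<7 kind _ _) (rank<7 k)
                     (trans (sym (colour-lin v)) (trans cv (sym (proj₂ (proj₂ (label-surjective k))))))

  member⇐ : ∀ v k → linᵛ kind v ≡ rank k → c v ≡ k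
  member⇐ v k e = trans (colour-lin v) (trans (cong label e) (proj₂ (proj₂ (label-surjective k))))

  -- Every class is the translate of class 0 by (0 , b), where b shifts the residue of class 0
  -- to that of class k.
  translate : ∀ k → IsTranslateOf (Class c k) (Class c Fin.zero)
  translate k = 0 , b , (λ { (i , j) → pull-back i j }) , (λ { (i , j) → push i j })
    where
    b : ℕ
    b = proj₁ (vertical-shift kind (rank Fin.zero) (rank k) (rank<7 Fin.zero) (rank<7 k))

    shifts-rank : (Δlin kind 0 b + rank Fin.zero) % 7 ≡ rank k
    shifts-rank = proj₂ (vertical-shift kind (rank Fin.zero) (rank k) (rank<7 Fin.zero) (rank<7 k))

    lin-τ : ∀ i j → linᵛ kind (shift i 0 , shift j b) ≡ (Δlin kind 0 b + linᵛ kind (i , j)) % 7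
    lin-τ i j = lin-shift 7∣m 7∣n kind i j 0 b

    push : ∀ i j → c (i , j) ≡ Fin.zero → c (shift i 0 , shift j b) ≡ k
    push i j cu = member⇐ _ k (begin
      linᵛ kind (shift i 0 , shift j b)          ≡⟨ lin-τ i j ⟩
      (Δlin kind 0 b + linᵛ kind (i , j)) % 7    ≡⟨ cong (λ r → (Δlin kind 0 b + r) % 7) (member⇒ (i , j) Fin.zero cu) ⟩
      (Δlin kind 0 b + rank Fin.zero) % 7        ≡⟨ shifts-rank ⟩
      rank k                                     ∎)

    -- Going back by b is going forward by b · n', as n' ≡ -1 modulo suc n'.
    back-forth : ∀ j → shift (shift j (b * n')) b ≡ j
    back-forth j = trans (shift-residue (suc n') (toℕ j + b * n') b)
                         (trans (residue-cong (suc n') {toℕ j + b * n' + b} {toℕ j} wrapped) (residue-toℕ (suc n') j))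
      where
      wrap : ∀ x b n' → x + b * n' + b ≡ x + b * suc n'
      wrap = solve-∀
      wrapped : (toℕ j + b * n' + b) % suc n' ≡ toℕ j % suc n'
      wrapped = trans (cong (_% suc n') (wrap (toℕ j) b n')) ([m+kn]%n≡m%n (toℕ j) b (suc n'))

    pull-back : ∀ i j → c (i , j) ≡ k →
                ∃[ u ] (c u ≡ Fin.zero × (i , j) ≡ (shift (proj₁ u) 0 , shift (proj₂ u) b))
    pull-back i j cv = u , member⇐ u Fin.zero lin-u , sym (cong₂ _,_ (shift-zero (suc m') i) (back-forth j))
      where
      u : V (suc m') (suc n')
      u = (i , shift j (b * n'))
      lin-u : linᵛ kind u ≡ rank Fin.zero
      lin-u = +-cancelˡ-% 7 (Δlin kind 0 b) (lin<7 kind _ _) (rank<7 Fin.zero) (begin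
        (Δlin kind 0 b + linᵛ kind u) % 7                   ≡⟨ lin-τ i (shift j (b * n')) ⟨
        linᵛ kind (shift i 0 , shift (shift j (b * n')) b)  ≡⟨ cong (linᵛ kind) (cong₂ _,_ (shift-zero (suc m') i) (back-forth j)) ⟩
        linᵛ kind (i , j)                                   ≡⟨ member⇒ (i , j) k cv ⟩
        rank k                                              ≡⟨ shifts-rank ⟨
        (Δlin kind 0 b + rank Fin.zero) % 7                 ∎)

  -- Each column {i} × ℤₙ meets every class in n / 7 vertices, so 7 · |Sᵏ| = m · n.
  size : ∀ k → 7 * classSize c k ≡ suc m' * suc n'
  size k = begin
    7 * classSize c k                   ≡⟨ cong (7 *_) (length-filter-product (λ v → c v ≟ k) (allFin (suc m')) (allFin (suc n')) q column) ⟩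
    7 * (length (allFin (suc m')) * q)  ≡⟨ cong (λ l → 7 * (l * q)) (length-tabulate {n = suc m'} (λ i → i)) ⟩
    7 * (suc m' * q)                    ≡⟨ rearrange 7 (suc m') q ⟩
    suc m' * (q * 7)                    ≡⟨ cong (suc m' *_) (sym n≡q*7) ⟩
    suc m' * suc n'                     ∎
    where
    q : ℕ
    q = _∣_.quotient 7∣n
    n≡q*7 : suc n' ≡ q * 7
    n≡q*7 = _∣_.equality 7∣n
    rearrange : ∀ a b c → a * (b * c) ≡ b * (c * a)
    rearrange = solve-∀

    column : ∀ i → length (filter (λ v → c v ≟ k) (map (i ,_) (allFin (suc n')))) ≡ q
    column i = begin
      length (filter (λ v → c v ≟ k) (map (i ,_) (allFin (suc n'))))  ≡⟨ cong (λ l → length (filter (λ v → c v ≟ k) l)) (map-tabulate (λ j → j) (i ,_)) ⟩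
      length (filter (λ v → c v ≟ k) (tabulate (i ,_)))                ≡⟨ length-filter-tabulate (λ v → c v ≟ k) (i ,_) h agree ⟩
      count (suc n') h                                                  ≡⟨ cong (λ w → count w h) n≡q*7 ⟩
      count (q * 7) h                                                   ≡⟨ count-periodic 7 q h periodic ⟩
      q * count 7 h                                                     ≡⟨ cong (q *_) (trans (count-cong 7 reduce) (once-per-period kind (toℕ i % 7) (rank k) (m%n<n (toℕ i) 7) (rank<7 k))) ⟩
      q * 1                                                             ≡⟨ *-identityʳ q ⟩
      q                                                                 ∎
      where
      h : ℕ → Bool
      h y = does (lin kind (toℕ i) y ℕ.≟ rank k)
      agree : ∀ j → does (c (i , j) ≟ k) ≡ h (toℕ j)
      agree j = does-⇔ (mk⇔ (member⇒ (i , j) k) (member⇐ (i , j) k)) (c (i , j) ≟ k) (lin kind (toℕ i) (toℕ j) ℕ.≟ rank k)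
      periodic : ∀ y → h (7 + y) ≡ h y
      periodic y = cong (λ r → does (r ℕ.≟ rank k)) (lin-cong kind {toℕ i} {toℕ i} {7 + y} {y} refl ([m+n]%n≡m%n' y))
        where
        [m+n]%n≡m%n' : ∀ y → (7 + y) % 7 ≡ y % 7
        [m+n]%n≡m%n' y = trans (cong (_% 7) (+-comm 7 y)) ([m+n]%n≡m%n y 7)
      reduce : ∀ y → h y ≡ does (lin kind (toℕ i % 7) y ℕ.≟ rank k)
      reduce y = cong (λ r → does (r ℕ.≟ rank k)) (lin-cong kind {toℕ i} {toℕ i % 7} {y} {y} (sym (m%n%n≡m%n (toℕ i) 7)) refl)

-- Under (x , y) ↦ x + 3y the six directions change the residue by the six non-zero residues.
weight : Dir → ℕ
weight east      = 1
weight west      = 6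
weight north     = 3
weight south     = 4
weight southeast = 5
weight northwest = 2

direction : ℕ → Dir
direction 1 = east
direction 6 = west
direction 3 = north
direction 4 = south
direction 5 = southeast
direction _ = northwest

direction-weight : ∀ d → direction (weight d) ≡ d
direction-weight east      = refl
direction-weight west      = refl
direction-weight north     = refl
direction-weight south     = refl
direction-weight southeast = refl
direction-weight northwest = refl

weight-injective : ∀ {d d'} → weight d ≡ weight d' → d ≡ d'
weight-injective {d} {d'} e = trans (sym (direction-weight d)) (trans (cong direction e) (direction-weight d'))

weight-nonzero : ∀ d → weight d ≢ 0
weight-nonzero east      ()
weight-nonzero west      ()
weight-nonzero north     ()
weight-nonzero south     ()
weight-nonzero southeast ()
weight-nonzero northwest ()

weight<7 : ∀ d → weight d < 7
weight<7 d = subst (_< 7) (weight%7 d) (m%n<n (weight d) 7)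
  where
  weight%7 : ∀ d → weight d % 7 ≡ weight d
  weight%7 east      = refl
  weight%7 west      = refl
  weight%7 north     = refl
  weight%7 south     = refl
  weight%7 southeast = refl
  weight%7 northwest = refl

reach : ∀ r k → r < 7 → k < 7 → r ≢ k → ∃[ d ] (weight d + r) % 7 ≡ k
reach r k r<7 k<7 r≢k with by-evaluation₂ (λ r k → (r ℕ.≟ k) ⊎-dec ((weight (direction ((7 + k ∸ r) % 7)) + r) % 7 ℕ.≟ k)) r k r<7 k<7
... | inj₁ r≡k = ⊥-elim (r≢k r≡k)
... | inj₂ e   = direction ((7 + k ∸ r) % 7) , e

-- For 7 ∣ m and 7 ∣ n, colouring each vertex by the residue of x + 3y partitions Δ_{m,n}
-- into seven perfect codes: the neighbours of a vertex carry the other six residues.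
module LinearColouring {m' n'} (7∣m : 7 ∣ suc m') (7∣n : 7 ∣ suc n') where

  Vertex : Set
  Vertex = V (suc m') (suc n')

  ℓ : Vertex → ℕ
  ℓ = linᵛ A

  colour : Vertex → Fin 7
  colour v = residue 7 (ℓ v)

  dx : Dir → ℕ
  dx east = 1
  dx west = m'
  dx north = 0
  dx south = 0
  dx southeast = 1
  dx northwest = m'

  dy : Dir → ℕ
  dy east = 0
  dy west = 0
  dy north = 1
  dy south = n'
  dy southeast = n'
  dy northwest = 1

  move-shift : ∀ d (i : Fin (suc m')) (j : Fin (suc n')) → move d (i , j) ≡ (shift i (dx d) , shift j (dy d))
  move-shift east      i j = cong (shift i 1 ,_) (sym (shift-zero (suc n') j))
  move-shift west      i j = cong (shift i m' ,_) (sym (shift-zero (suc n') j))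
  move-shift north     i j = cong (_, shift j 1) (sym (shift-zero (suc m') i))
  move-shift south     i j = cong (_, shift j n') (sym (shift-zero (suc m') i))
  move-shift southeast i j = refl
  move-shift northwest i j = refl

  m'≡6 : m' % 7 ≡ 6
  m'≡6 = %-pred-≡0 {m'} {7} (n∣m⇒m%n≡0 (suc m') 7 7∣m)

  n'≡6 : n' % 7 ≡ 6
  n'≡6 = %-pred-≡0 {n'} {7} (n∣m⇒m%n≡0 (suc n') 7 7∣n)

  Δlin-weight : ∀ d → Δlin A (dx d) (dy d) % 7 ≡ weight d % 7
  Δlin-weight east      = refl
  Δlin-weight west      = lin-cong A {m'} {6} {0} {0} m'≡6 refl
  Δlin-weight north     = refl
  Δlin-weight south     = lin-cong A {0} {0} {n'} {6} refl n'≡6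
  Δlin-weight southeast = lin-cong A {1} {1} {n'} {6} refl n'≡6
  Δlin-weight northwest = lin-cong A {m'} {6} {1} {1} m'≡6 refl

  lin-move : ∀ d (v : Vertex) → ℓ (move d v) ≡ (weight d + ℓ v) % 7
  lin-move d (i , j) = begin
    ℓ (move d (i , j))                           ≡⟨ cong ℓ (move-shift d i j) ⟩
    ℓ (shift i (dx d) , shift j (dy d))          ≡⟨ lin-shift 7∣m 7∣n A i j (dx d) (dy d) ⟩
    (Δlin A (dx d) (dy d) + ℓ (i , j)) % 7       ≡⟨ %-cong-+ 7 {Δlin A (dx d) (dy d)} {weight d} {ℓ (i , j)} (Δlin-weight d) refl ⟩
    (weight d + ℓ (i , j)) % 7                   ∎

  lin<7ᵛ : ∀ (v : Vertex) → ℓ v < 7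
  lin<7ᵛ (i , j) = lin<7 A (toℕ i) (toℕ j)

  in-class⇒ : ∀ (v : Vertex) k → colour v ≡ k → ℓ v ≡ toℕ k
  in-class⇒ v k e = trans (sym (m<n⇒m%n≡m (lin<7ᵛ v))) (trans (sym (toℕ-residue 7 (ℓ v))) (cong toℕ e))

  in-class⇐ : ∀ (v : Vertex) k → ℓ v ≡ toℕ k → colour v ≡ k
  in-class⇐ v k e = trans (cong (residue 7) e) (residue-toℕ 7 k)

  same-residue : ∀ d d' (v : Vertex) → ℓ (move d v) ≡ ℓ (move d' v) → weight d ≡ weight d'
  same-residue d d' v e = +-cancelʳ-% 7 (ℓ v) (weight<7 d) (weight<7 d')
    (trans (sym (lin-move d v)) (trans e (lin-move d' v)))

  partition : SevenCodePartition colour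
  partition k = independent , dominated
    where
    independent : ∀ u v → colour u ≡ k → colour v ≡ k → ¬ Adj u v
    independent u v cu cv adj with adjacent-move u v adj
    ... | d , refl = weight-nonzero d (+-cancelʳ-% 7 (ℓ u) (weight<7 d) (s≤s z≤n) (begin
      (weight d + ℓ u) % 7    ≡⟨ lin-move d u ⟨
      ℓ (move d u)            ≡⟨ trans (in-class⇒ (move d u) k cv) (sym (in-class⇒ u k cu)) ⟩
      ℓ u                     ≡⟨ m<n⇒m%n≡m (lin<7ᵛ u) ⟨
      ℓ u % 7                 ∎))

    dominated : ∀ v → ¬ colour v ≡ k →
                (∃[ u ] (colour u ≡ k × Adj v u)) × (∀ u u' → colour u ≡ k → Adj v u → colour u' ≡ k → Adj v u' → u ≡ u')
    dominated v v∉k = (move d v , in-class⇐ (move d v) k (trans (lin-move d v) reaches) , move-adjacent d v) , unique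
      where
      d : Dir
      d = proj₁ (reach (ℓ v) (toℕ k) (lin<7ᵛ v) (toℕ<n k) (λ e → v∉k (in-class⇐ v k e)))
      reaches : (weight d + ℓ v) % 7 ≡ toℕ k
      reaches = proj₂ (reach (ℓ v) (toℕ k) (lin<7ᵛ v) (toℕ<n k) (λ e → v∉k (in-class⇐ v k e)))

      unique : ∀ u u' → colour u ≡ k → Adj v u → colour u' ≡ k → Adj v u' → u ≡ u'
      unique u u' cu vu cu' vu' with adjacent-move v u vu | adjacent-move v u' vu'
      ... | d₁ , refl | d₂ , refl = cong (λ d → move d v) (weight-injective
            (same-residue d₁ d₂ v (trans (in-class⇒ (move d₁ v) k cu) (sym (in-class⇒ (move d₂ v) k cu')))))

corollary3 : (m n : ℕ) → .{{_ : NonZero m}} → .{{_ : NonZero n}} → 3 ≤ m → 3 ≤ n →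
    ((∃ λ (c : V m n → Fin 7) → SevenCodePartition c) ⇔ (7 ∣ m × 7 ∣ n))
    × (∀ (c : V m n → Fin 7) → SevenCodePartition c →
         ∀ k → IsTranslateOf (Class c k) (Class c Fin.zero) × 7 * classSize c k ≡ m * n)
corollary3 (suc (suc (suc m₃))) (suc (suc (suc n₃))) 3≤m@(s≤s (s≤s (s≤s _))) 3≤n@(s≤s (s≤s (s≤s _))) =
  mk⇔ (λ (c , H) → Linear.7∣m (linear c H) , Linear.7∣n (linear c H))
      (λ (7∣m , 7∣n) → LinearColouring.colour 7∣m 7∣n , LinearColouring.partition 7∣m 7∣n)
  , λ c H k → Classes.translate c (linear c H) k , Classes.size c (linear c H) k
  where
  linear : ∀ (c : V (3 + m₃) (3 + n₃) → Fin 7) → SevenCodePartition c → Linear (Lift.lift c) (3 + m₃) (3 + n₃)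
  linear c H = linearity (Lift.lift c) m₃ n₃ (Lift.lift-periodicˣ c) (Lift.lift-periodicʸ c)
                         (Lift.lift-rainbow c H 3≤m 3≤n)
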